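{- Let $k\ge1$, $m=2^{k-1}$, let $\mathcal C\subseteq Z_{2^k}^n$ be a code and $\tilde C=\Phi(\mathcal C)$, with $\Phi$ defined below via the partition $\{H_0,\dots,H_{2m-1}\}$. Then $$W_{\tilde C}(X,Y)=SW_{\mathcal C}\big(W_{H_0}(X,Y),\,W_{H_1}(X,Y),\,W_{H_2}(X,Y)\big),$$ where $\bar 0\in H_0$, $H_1$ consists of odd-weight words, and $H_2$ consists of even-weight words and does not contain $\bar0$.
   Context: Let $\{H_0,\dots,H_{2m-1}\}$ be a partition of $Z_2^m$ into extended $1$-perfect binary $(m,2^m/2m,4)$-codes (sets of $2^m/2m$ words with pairwise Hamming distance at least $4$) such that $H_0$ contains the all-zero word $\bar0$ and all words of $H_j$ have Hamming weight of the parity of $j$. Define $\Phi(x_1,\dots,x_n)=H_{x_1}\times\dots\times H_{x_n}\subseteq Z_2^{mn}$ and $\Phi(\mathcal C)=\bigcup_{\bar x\in\mathcal C}\Phi(\bar x)$. For a binary code $C$ of length $N$, $W_C(X,Y)=\sum_{c\in C}X^{N-wt(c)}Y^{wt(c)}$ (Hamming weight $wt$). For $\mathcal C\subseteq Z_{2^k}^n$, the complete weight enumerator is $W_{\mathcal C}(X_0,\dots,X_{2^k-1})=\sum_{\bar c\in\mathcal C}\prod_{i=1}^n X_{c_i}$, and $SW_{\mathcal C}(X,Z,T)$ is obtained from it by substituting $X_0\mapsto X$, $X_j\mapsto Z$ for all odd $j$, and $X_j\mapsto T$ for all even $j\ne0$. -}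

module Defs where

open import Level using (Level)
open import Data.Bool using (Bool; true; false; if_then_else_; _∧_; _∨_; _xor_)
open import Data.Nat using (ℕ; zero; suc; _+_; _*_; _∸_; _^_; _≤_; _%_; _≡ᵇ_)
open import Data.Fin using (Fin; toℕ; _≟_)
open import Data.Vec using (Vec; []; _∷_; concat; zipWith; replicate)
import Data.Vec as Vec
open import Data.List using (List; []; _∷_; [_]; concatMap; filter; length; foldr; allFin)
import Data.List as List
open import Relation.Nullary using (¬_)
open import Relation.Nullary.Decidable using (⌊_⌋)
open import Relation.Binary.PropositionalEquality using (_≡_)
open import Algebra.Bundles using (CommutativeSemiring)

-- Hamming weight of a binary word (Z_2 represented by Bool, true = 1)
wt : ∀ {N} → Vec Bool N → ℕ
wt [] = 0
wt (true ∷ w) = suc (wt w)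
wt (false ∷ w) = wt w

dist : ∀ {N} → Vec Bool N → Vec Bool N → ℕ
dist u v = wt (zipWith _xor_ u v)

allVecs : ∀ {a} {A : Set a} → List A → (n : ℕ) → List (Vec A n)
allVecs xs zero = [ [] ]
allVecs xs (suc n) = concatMap (λ x → List.map (x ∷_) (allVecs xs n)) xs

allWords : (N : ℕ) → List (Vec Bool N)
allWords N = allVecs (false ∷ true ∷ []) N

allCodeWords : (q n : ℕ) → List (Vec (Fin q) n)
allCodeWords q n = allVecs (allFin q) n

mOf : ℕ → ℕ
mOf k = 2 ^ (k ∸ 1)

-- A map h : Z_2^m → Z_{2^k} represents the partition {H_0,...,H_{2m-1}},
-- H_j = { w | h w = j }.  Membership of w in H_j, for an index j : ℕ
-- (H_j is empty when j ≥ 2^k).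
inH : ∀ {m q} → (Vec Bool m → Fin q) → ℕ → Vec Bool m → Bool
inH h j w = toℕ (h w) ≡ᵇ j

sizeH : ∀ {m q} → (Vec Bool m → Fin q) → ℕ → ℕ
sizeH {m} h j = length (filter (λ w → toℕ (h w) Data.Nat.≟ j) (allWords m))

-- Hypotheses: {H_0,...,H_{2m-1}} is a partition of Z_2^m into extended
-- 1-perfect (m, 2^m/2m, 4)-codes, 0̄ ∈ H_0, and every word of H_j has
-- weight of the parity of j.  (2m = 2^k; the size condition |H_j| = 2^m/2m
-- is written |H_j| * 2m = 2^m.)
record ExtPerfectPartition (k : ℕ) (h : Vec Bool (mOf k) → Fin (2 ^ k)) : Set where
  field
    size     : ∀ (j : Fin (2 ^ k)) → sizeH h (toℕ j) * (2 * mOf k) ≡ 2 ^ mOf k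
    distance : ∀ (u v : Vec Bool (mOf k)) → h u ≡ h v → ¬ (u ≡ v) → 4 ≤ dist u v
    zeroInH0 : toℕ (h (replicate (mOf k) false)) ≡ 0
    parity   : ∀ (w : Vec Bool (mOf k)) → wt w % 2 ≡ toℕ (h w) % 2

-- Φ(x̄) = H_{x_1} × ... × H_{x_n}, with (Z_2^m)^n (blocks) as elements
inΦx : ∀ {m q n} → (Vec Bool m → Fin q) → Vec (Fin q) n → Vec (Vec Bool m) n → Bool
inΦx h x w = Vec.foldr _ _∧_ true (zipWith (λ wi xi → ⌊ h wi ≟ xi ⌋) w x)

-- Φ(C) = ⋃_{x̄ ∈ C} Φ(x̄); a code C ⊆ Z_q^n is given by its characteristic function
inΦ : ∀ {m q n} → (Vec Bool m → Fin q) → (Vec (Fin q) n → Bool) → Vec (Vec Bool m) n → Bool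
inΦ {q = q} {n = n} h C w =
  List.foldr _∨_ false (List.map (λ x → C x ∧ inΦx h x w) (allCodeWords q n))

module Enumerators {c ℓ : Level} (R : CommutativeSemiring c ℓ) where
  open CommutativeSemiring R using (Carrier; 0#; 1#) renaming (_+_ to _⊕_; _*_ to _⊗_)

  pow : Carrier → ℕ → Carrier
  pow x zero = 1#
  pow x (suc n) = x ⊗ pow x n

  sumL : List Carrier → Carrier
  sumL = foldr _⊕_ 0#

  prodV : ∀ {n} → Vec Carrier n → Carrier
  prodV = Vec.foldr _ _⊗_ 1#

  W : (N : ℕ) → (Vec Bool N → Bool) → Carrier → Carrier → Carrier
  W N D X Y = sumL (List.map (λ w → if D w then pow X (N ∸ wt w) ⊗ pow Y (wt w) else 0#) (allWords N))

  WH : ∀ {m q} → (Vec Bool m → Fin q) → ℕ → Carrier → Carrier → Carrier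
  WH {m} h j X Y = W m (inH h j) X Y

  -- W_{Φ(C)}(X,Y), where a word of Φ(C) ⊆ (Z_2^m)^n is viewed in Z_2^{mn}
  -- by concatenating its blocks
  WΦ : ∀ {m q n} → (Vec Bool m → Fin q) → (Vec (Fin q) n → Bool) → Carrier → Carrier → Carrier
  WΦ {m} {q} {n} h C X Y =
    sumL (List.map (λ w → if inΦ h C w
                            then pow X (n * m ∸ wt (concat w)) ⊗ pow Y (wt (concat w))
                            else 0#)
                   (allVecs (allWords m) n))

  CWE : ∀ {q n} → (Vec (Fin q) n → Bool) → (Fin q → Carrier) → Carrier
  CWE {q} {n} C Xs = sumL (List.map (λ x → if C x then prodV (Vec.map Xs x) else 0#) (allCodeWords q n))

  swSubst : ∀ {q} → Carrier → Carrier → Carrier → Fin q → Carrier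
  swSubst X Z T j = if toℕ j ≡ᵇ 0 then X else (if toℕ j % 2 ≡ᵇ 1 then Z else T)

  SW : ∀ {q n} → (Vec (Fin q) n → Bool) → Carrier → Carrier → Carrier → Carrier
  SW C X Z T = CWE C (swSubst X Z T)

-- A word of Φ(C) is a concatenation of blocks w₁ ∈ H_{x₁}, …, w_n ∈ H_{x_n} with x̄ ∈ C, and its weight
-- monomial is the product of those of its blocks; so W_{Φ(C)} is the complete weight enumerator of C at
-- X_j ↦ W_{H_j}. It remains to see that W_{H_j} depends only on whether j is 0, odd or even.
-- The words of H_j all have the parity of j, lie at mutual distance ≥ 4 and satisfy |H_j| · m = 2^(m-1),
-- so the radius-1 balls around them are disjoint and cover exactly the 2^(m-1) words of the other parity.
-- Counting the pairs (c, v) with c ∈ H_j, d(c, v) = 1 and wt v = i + 1 gives, for the weight distribution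
-- A of H_j, A_i (m - i) + A_(i+2) (i + 2) = #{v of the other parity : wt v = i + 1}, and similarly
-- A_1 = #{v of the other parity : wt v = 0}. For j ≠ 0 also A_0 = 0 (as 0̄ ∈ H_0), so A is determined by
-- the parity of j.

module Submission where

open import Defs
open import Level using (Level)
open import Function using (id; _∘′_)
open import Function.Bundles using (Equivalence)
open import Data.Bool using (Bool; true; false; T; not; if_then_else_; _∧_; _xor_)
import Data.Bool.Properties as Boolₚ
open import Data.Bool.ListAction using (any)
open import Data.Nat as ℕ using (ℕ; zero; suc; _+_; _*_; _∸_; _^_; _≤_; _<_; _%_; _≡ᵇ_; z≤n; s≤s; pred)
open import Data.Fin as Fin using (Fin; toℕ)
open import Data.Product using (_,_)
open import Data.Empty using (⊥-elim)
open import Data.Vec using (Vec; []; _∷_)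
import Data.Vec as Vec
import Data.Vec.Properties as Vecₚ
open import Data.List using (List; []; _∷_; _++_; concatMap; allFin)
import Data.List as List
import Data.List.Properties as Listₚ
open import Data.List.Membership.Propositional using (_∈_)
open import Data.List.Membership.Propositional.Properties using (∈-allFin)
open import Data.List.Relation.Unary.Any as Any using (here; there)
import Data.List.Relation.Unary.Any.Properties as Anyₚ
open import Relation.Nullary using (yes; no; contradiction)
open import Relation.Binary.PropositionalEquality as ≡ using (_≡_; _≢_; subst)
open import Algebra.Bundles using (CommutativeSemiring)

module Sums {c ℓ : Level} (R : CommutativeSemiring c ℓ) where
  open CommutativeSemiring R renaming (_+_ to _⊕_; _*_ to _⊗_)
  open Enumerators R using (sumL)
  open import Algebra.Properties.CommutativeSemigroup +-commutativeSemigroup using (interchange)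

  ∑ : {A : Set} → List A → (A → Carrier) → Carrier
  ∑ L f = sumL (List.map f L)

  private variable A B : Set

  ∑-cong : ∀ (L : List A) {f g : A → Carrier} → (∀ a → f a ≈ g a) → ∑ L f ≈ ∑ L g
  ∑-cong []      f≈g = refl
  ∑-cong (a ∷ L) f≈g = +-cong (f≈g a) (∑-cong L f≈g)

  ∑-++ : ∀ (L L′ : List A) f → ∑ (L ++ L′) f ≈ ∑ L f ⊕ ∑ L′ f
  ∑-++ []      L′ f = sym (+-identityˡ _)
  ∑-++ (a ∷ L) L′ f = trans (+-congˡ (∑-++ L L′ f)) (sym (+-assoc _ _ _))

  ∑-zero : ∀ (L : List A) → ∑ L (λ _ → 0#) ≈ 0#
  ∑-zero []      = refl
  ∑-zero (a ∷ L) = trans (+-identityˡ _) (∑-zero L)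

  ∑-distrib-+ : ∀ (L : List A) f g → ∑ L (λ a → f a ⊕ g a) ≈ ∑ L f ⊕ ∑ L g
  ∑-distrib-+ []      f g = sym (+-identityˡ 0#)
  ∑-distrib-+ (a ∷ L) f g = trans (+-congˡ (∑-distrib-+ L f g)) (interchange _ _ _ _)

  *-distribˡ-∑ : ∀ (L : List A) x f → x ⊗ ∑ L f ≈ ∑ L (λ a → x ⊗ f a)
  *-distribˡ-∑ []      x f = zeroʳ x
  *-distribˡ-∑ (a ∷ L) x f = trans (distribˡ x _ _) (+-congˡ (*-distribˡ-∑ L x f))

  *-distribʳ-∑ : ∀ (L : List A) x f → ∑ L f ⊗ x ≈ ∑ L (λ a → f a ⊗ x)
  *-distribʳ-∑ L x f = trans (*-comm _ x) (trans (*-distribˡ-∑ L x f) (∑-cong L (λ a → *-comm x (f a))))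

  ∑-comm : ∀ (L : List A) (L′ : List B) (f : A → B → Carrier) →
           ∑ L (λ a → ∑ L′ (f a)) ≈ ∑ L′ (λ b → ∑ L (λ a → f a b))
  ∑-comm []      L′ f = sym (∑-zero L′)
  ∑-comm (a ∷ L) L′ f =
    trans (+-congˡ (∑-comm L L′ f)) (sym (∑-distrib-+ L′ (f a) (λ b → ∑ L (λ a → f a b))))

  ∑-map : ∀ (L : List B) (g : B → A) f → ∑ (List.map g L) f ≈ ∑ L (f ∘′ g)
  ∑-map []      g f = refl
  ∑-map (b ∷ L) g f = +-congˡ (∑-map L g f)

  ∑-concatMap : ∀ (L : List B) (g : B → List A) f → ∑ (concatMap g L) f ≈ ∑ L (λ b → ∑ (g b) f)
  ∑-concatMap []      g f = refl
  ∑-concatMap (b ∷ L) g f = trans (∑-++ (g b) _ f) (+-congˡ (∑-concatMap L g f))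

  ∑-allVecs-suc : ∀ (xs : List A) n (f : Vec A (suc n) → Carrier) →
    ∑ (allVecs xs (suc n)) f ≈ ∑ xs (λ x → ∑ (allVecs xs n) (λ v → f (x ∷ v)))
  ∑-allVecs-suc xs n f = trans (∑-concatMap xs _ f) (∑-cong xs (λ x → ∑-map (allVecs xs n) (x ∷_) f))

  ∑-allWords-suc : ∀ m (f : Vec Bool (suc m) → Carrier) →
    ∑ (allWords (suc m)) f ≈ ∑ (allWords m) (λ v → f (false ∷ v)) ⊕ ∑ (allWords m) (λ v → f (true ∷ v))
  ∑-allWords-suc m f = trans (∑-allVecs-suc (false ∷ true ∷ []) m f) (+-congˡ (+-identityʳ _))

  ∑-allFin-suc : ∀ q (f : Fin (suc q) → Carrier) →
    ∑ (allFin (suc q)) f ≈ f Fin.zero ⊕ ∑ (allFin q) (f ∘′ Fin.suc)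
  ∑-allFin-suc q f = +-congˡ (trans (reflexive tail≡) (∑-map (allFin q) Fin.suc f))
    where
    tail≡ : ∑ (List.tabulate Fin.suc) f ≡ ∑ (List.map Fin.suc (allFin q)) f
    tail≡ = ≡.cong (λ L → ∑ L f) (≡.sym (Listₚ.map-tabulate id Fin.suc))

module Counting where
  open import Data.Nat.Properties
  open import Data.Product using (∃; _×_; proj₁)
  open import Data.Sum using (inj₁; inj₂)
  open ≡ using (cong; cong₂; module ≡-Reasoning)
  open import Algebra.Properties.CommutativeSemigroup +-commutativeSemigroup
    using (interchange; x∙yz≈y∙xz)
  open Sums +-*-commutativeSemiring public

  ⟦_⟧ : Bool → ℕ
  ⟦ true ⟧  = 1
  ⟦ false ⟧ = 0

  ⟦⟧≤1 : ∀ b → ⟦ b ⟧ ≤ 1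
  ⟦⟧≤1 true  = s≤s z≤n
  ⟦⟧≤1 false = z≤n

  private variable A : Set

  ∑-mono-≤ : ∀ (L : List A) {f g : A → ℕ} → (∀ a → f a ≤ g a) → ∑ L f ≤ ∑ L g
  ∑-mono-≤ []      f≤g = z≤n
  ∑-mono-≤ (a ∷ L) f≤g = +-mono-≤ (f≤g a) (∑-mono-≤ L f≤g)

  ≤-≤-+-≡⇒≡ˡ : ∀ {a b c d} → a ≤ c → b ≤ d → a + b ≡ c + d → a ≡ c
  ≤-≤-+-≡⇒≡ˡ a≤c b≤d eq with m≤n⇒m<n∨m≡n a≤c
  ... | inj₂ a≡c = a≡c
  ... | inj₁ a<c = ⊥-elim (<-irrefl eq (+-mono-<-≤ a<c b≤d))

  ∑-≤-≡⇒≡ : ∀ (L : List A) {f g : A → ℕ} → (∀ a → f a ≤ g a) → ∑ L f ≡ ∑ L g →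
            ∀ {a} → a ∈ L → f a ≡ g a
  ∑-≤-≡⇒≡ (a ∷ L) f≤g eq (here ≡.refl)       = ≤-≤-+-≡⇒≡ˡ (f≤g a) (∑-mono-≤ L f≤g) eq
  ∑-≤-≡⇒≡ (a ∷ L) {f} {g} f≤g eq (there a∈L) = ∑-≤-≡⇒≡ L f≤g tail-eq a∈L
    where
    tail-eq : ∑ L f ≡ ∑ L g
    tail-eq = +-cancelˡ-≡ (f a) _ _
      (≡.trans eq (cong (_+ ∑ L g) (≡.sym (≤-≤-+-≡⇒≡ˡ (f≤g a) (∑-mono-≤ L f≤g) eq))))

  ∑-pos⇒∃-pos : ∀ (L : List A) (f : A → ℕ) → 0 < ∑ L f → ∃ λ a → 0 < f a
  ∑-pos⇒∃-pos (a ∷ L) f 0<∑ with f a in fa≡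
  ... | suc _ = a , subst (0 <_) (≡.sym fa≡) (s≤s z≤n)
  ... | zero  = ∑-pos⇒∃-pos L f 0<∑

  ∑-allWords-≤1 : ∀ m (f : Vec Bool m → ℕ) → (∀ v → f v ≤ 1) → (∀ u v → 0 < f u → 0 < f v → u ≡ v) →
                  ∑ (allWords m) f ≤ 1
  ∑-allWords-≤1 zero    f f≤1 unique = subst (_≤ 1) (≡.sym (+-identityʳ _)) (f≤1 [])
  ∑-allWords-≤1 (suc m) f f≤1 unique = subst (_≤ 1) (≡.sym (∑-allWords-suc m f)) (halves ∑₀≤1 ∑₁≤1)
    where
    f₀ f₁ : Vec Bool m → ℕ
    f₀ v = f (false ∷ v)
    f₁ v = f (true ∷ v)
    ∑₀≤1 : ∑ (allWords m) f₀ ≤ 1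
    ∑₀≤1 = ∑-allWords-≤1 m f₀ (λ v → f≤1 _) (λ u v p q → Vecₚ.∷-injectiveʳ (unique _ _ p q))
    ∑₁≤1 : ∑ (allWords m) f₁ ≤ 1
    ∑₁≤1 = ∑-allWords-≤1 m f₁ (λ v → f≤1 _) (λ u v p q → Vecₚ.∷-injectiveʳ (unique _ _ p q))
    halves : ∑ (allWords m) f₀ ≤ 1 → ∑ (allWords m) f₁ ≤ 1 → ∑ (allWords m) f₀ + ∑ (allWords m) f₁ ≤ 1
    halves p q with ∑ (allWords m) f₀ in e₀ | ∑ (allWords m) f₁ in e₁
    ... | zero  | _     = q
    ... | suc _ | zero  = subst (_≤ 1) (≡.sym (+-identityʳ _)) p
    ... | suc _ | suc _ with ∑-pos⇒∃-pos (allWords m) f₀ (subst (0 <_) (≡.sym e₀) (s≤s z≤n))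
                           | ∑-pos⇒∃-pos (allWords m) f₁ (subst (0 <_) (≡.sym e₁) (s≤s z≤n))
    ...   | u , 0<f₀u | v , 0<f₁v with unique _ _ 0<f₀u 0<f₁v
    ...     | ()

  ∑-allWords-1 : ∀ m → ∑ (allWords m) (λ _ → 1) ≡ 2 ^ m
  ∑-allWords-1 zero    = ≡.refl
  ∑-allWords-1 (suc m) = ≡.trans (∑-allWords-suc m _)
    (cong₂ _+_ (∑-allWords-1 m) (≡.trans (∑-allWords-1 m) (≡.sym (+-identityʳ _))))

  length-filter-≟ : ∀ (L : List A) (f : A → ℕ) j →
    List.length (List.filter (λ a → f a ℕ.≟ j) L) ≡ ∑ L (λ a → ⟦ f a ≡ᵇ j ⟧)
  length-filter-≟ []      f j = ≡.refl
  length-filter-≟ (a ∷ L) f j with f a ≡ᵇ j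
  ... | true  = cong suc (length-filter-≟ L f j)
  ... | false = length-filter-≟ L f j

  wt-≤ : ∀ {N} (w : Vec Bool N) → wt w ≤ N
  wt-≤ []          = z≤n
  wt-≤ (true ∷ w)  = s≤s (wt-≤ w)
  wt-≤ (false ∷ w) = m≤n⇒m≤1+n (wt-≤ w)

  wt≡0⇒≡zero : ∀ {N} (w : Vec Bool N) → wt w ≡ 0 → w ≡ Vec.replicate N false
  wt≡0⇒≡zero []          _ = ≡.refl
  wt≡0⇒≡zero (false ∷ w) e = cong (false ∷_) (wt≡0⇒≡zero w e)

  wt-++ : ∀ {a b} (u : Vec Bool a) (v : Vec Bool b) → wt (u Vec.++ v) ≡ wt u + wt v
  wt-++ []          v = ≡.refl
  wt-++ (true ∷ u)  v = cong suc (wt-++ u v)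
  wt-++ (false ∷ u) v = wt-++ u v

  dist≡0⇒≡ : ∀ {N} (u v : Vec Bool N) → dist u v ≡ 0 → u ≡ v
  dist≡0⇒≡ []          []          _ = ≡.refl
  dist≡0⇒≡ (false ∷ u) (false ∷ v) e = cong (false ∷_) (dist≡0⇒≡ u v e)
  dist≡0⇒≡ (true ∷ u)  (true ∷ v)  e = cong (true ∷_) (dist≡0⇒≡ u v e)

  dist-comm : ∀ {N} (u v : Vec Bool N) → dist u v ≡ dist v u
  dist-comm []          []          = ≡.refl
  dist-comm (false ∷ u) (false ∷ v) = dist-comm u v
  dist-comm (false ∷ u) (true ∷ v)  = cong suc (dist-comm u v)
  dist-comm (true ∷ u)  (false ∷ v) = cong suc (dist-comm u v)
  dist-comm (true ∷ u)  (true ∷ v)  = dist-comm u v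

  dist-∷ : ∀ {N} x y (u v : Vec Bool N) → dist (x ∷ u) (y ∷ v) ≡ ⟦ x xor y ⟧ + dist u v
  dist-∷ false false u v = ≡.refl
  dist-∷ false true  u v = ≡.refl
  dist-∷ true  false u v = ≡.refl
  dist-∷ true  true  u v = ≡.refl

  xor-triangle : ∀ x y z → ⟦ x xor z ⟧ ≤ ⟦ x xor y ⟧ + ⟦ y xor z ⟧
  xor-triangle false false z     = ≤-refl
  xor-triangle false true  false = z≤n
  xor-triangle false true  true  = s≤s z≤n
  xor-triangle true  false false = s≤s z≤n
  xor-triangle true  false true  = z≤n
  xor-triangle true  true  z     = ≤-refl

  dist-triangle : ∀ {N} (u v w : Vec Bool N) → dist u w ≤ dist u v + dist v w
  dist-triangle []      []      []      = z≤n
  dist-triangle (x ∷ u) (y ∷ v) (z ∷ w) = begin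
    dist (x ∷ u) (z ∷ w)
      ≡⟨ dist-∷ x z u w ⟩
    ⟦ x xor z ⟧ + dist u w
      ≤⟨ +-mono-≤ (xor-triangle x y z) (dist-triangle u v w) ⟩
    (⟦ x xor y ⟧ + ⟦ y xor z ⟧) + (dist u v + dist v w)
      ≡⟨ interchange ⟦ x xor y ⟧ ⟦ y xor z ⟧ (dist u v) (dist v w) ⟩
    (⟦ x xor y ⟧ + dist u v) + (⟦ y xor z ⟧ + dist v w)
      ≡⟨ cong₂ _+_ (dist-∷ x y u v) (dist-∷ y z v w) ⟨
    dist (x ∷ u) (y ∷ v) + dist (y ∷ v) (z ∷ w)
      ∎
    where open ≤-Reasoning

  odd : ℕ → Bool
  odd zero    = false
  odd (suc n) = not (odd n)

  %2≡ᵇ1≡odd : ∀ n → (n % 2 ≡ᵇ 1) ≡ odd n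
  %2≡ᵇ1≡odd zero          = ≡.refl
  %2≡ᵇ1≡odd (suc zero)    = ≡.refl
  %2≡ᵇ1≡odd (suc (suc n)) = ≡.trans (%2≡ᵇ1≡odd n) (≡.sym (Boolₚ.not-involutive (odd n)))

  odd-cong-%2 : ∀ a b → a % 2 ≡ b % 2 → odd a ≡ odd b
  odd-cong-%2 a b eq = ≡.trans (≡.sym (%2≡ᵇ1≡odd a)) (≡.trans (cong (_≡ᵇ 1) eq) (%2≡ᵇ1≡odd b))

  dist≡1⇒odd-wt-flips : ∀ {N} (c v : Vec Bool N) → dist c v ≡ 1 → odd (wt v) ≡ not (odd (wt c))
  dist≡1⇒odd-wt-flips []          []          ()
  dist≡1⇒odd-wt-flips (false ∷ c) (false ∷ v) d≡1 = dist≡1⇒odd-wt-flips c v d≡1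
  dist≡1⇒odd-wt-flips (true ∷ c)  (true ∷ v)  d≡1 = cong not (dist≡1⇒odd-wt-flips c v d≡1)
  dist≡1⇒odd-wt-flips (false ∷ c) (true ∷ v)  d≡1 rewrite dist≡0⇒≡ c v (cong pred d≡1) = ≡.refl
  dist≡1⇒odd-wt-flips (true ∷ c)  (false ∷ v) d≡1 rewrite dist≡0⇒≡ c v (cong pred d≡1) =
    ≡.sym (Boolₚ.not-involutive _)

  ∑-dist≡0-* : ∀ m (c : Vec Bool m) (f : Vec Bool m → ℕ) →
    ∑ (allWords m) (λ v → ⟦ dist c v ≡ᵇ 0 ⟧ * f v) ≡ f c
  ∑-dist≡0-* zero    []          f = ≡.trans (+-identityʳ _) (*-identityˡ _)
  ∑-dist≡0-* (suc m) (false ∷ c) f = ≡.trans (∑-allWords-suc m _)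
    (≡.trans (cong₂ _+_ (∑-dist≡0-* m c (λ v → f (false ∷ v))) (∑-zero (allWords m))) (+-identityʳ _))
  ∑-dist≡0-* (suc m) (true ∷ c)  f = ≡.trans (∑-allWords-suc m _)
    (cong₂ _+_ (∑-zero (allWords m)) (∑-dist≡0-* m c (λ v → f (true ∷ v))))

  ∑-dist≡0 : ∀ m (c : Vec Bool m) → ∑ (allWords m) (λ v → ⟦ dist c v ≡ᵇ 0 ⟧) ≡ 1
  ∑-dist≡0 m c =
    ≡.trans (∑-cong (allWords m) (λ v → ≡.sym (*-identityʳ _))) (∑-dist≡0-* m c (λ _ → 1))

  ∑-dist≡1 : ∀ m (c : Vec Bool m) → ∑ (allWords m) (λ v → ⟦ dist c v ≡ᵇ 1 ⟧) ≡ m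
  ∑-dist≡1 zero    []          = ≡.refl
  ∑-dist≡1 (suc m) (false ∷ c) =
    ≡.trans (∑-allWords-suc m _) (≡.trans (cong₂ _+_ (∑-dist≡1 m c) (∑-dist≡0 m c)) (+-comm m 1))
  ∑-dist≡1 (suc m) (true ∷ c)  = ≡.trans (∑-allWords-suc m _) (cong₂ _+_ (∑-dist≡0 m c) (∑-dist≡1 m c))

  neighboursOfWeight : ∀ {m} → Vec Bool m → ℕ → ℕ
  neighboursOfWeight {m} c i = ∑ (allWords m) (λ v → ⟦ dist c v ≡ᵇ 1 ⟧ * ⟦ wt v ≡ᵇ i ⟧)

  neighboursOfWeight≡ : ∀ m (c : Vec Bool m) i →
    neighboursOfWeight c i ≡ ⟦ suc (wt c) ≡ᵇ i ⟧ * (m ∸ wt c) + ⟦ wt c ≡ᵇ suc i ⟧ * wt c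
  neighboursOfWeight≡ zero    []          i = ≡.sym (≡.trans (+-identityʳ _) (*-zeroʳ ⟦ 1 ≡ᵇ i ⟧))
  neighboursOfWeight≡ (suc m) (false ∷ c) i = begin
    neighboursOfWeight (false ∷ c) i
      ≡⟨ ∑-allWords-suc m _ ⟩
    neighboursOfWeight c i + ∑ (allWords m) (λ v → ⟦ dist c v ≡ᵇ 0 ⟧ * ⟦ suc (wt v) ≡ᵇ i ⟧)
      ≡⟨ cong₂ _+_ (neighboursOfWeight≡ m c i) (∑-dist≡0-* m c (λ v → ⟦ suc (wt v) ≡ᵇ i ⟧)) ⟩
    a * (m ∸ w) + b * w + a
      ≡⟨ +-comm _ a ⟩
    a + (a * (m ∸ w) + b * w)
      ≡⟨ +-assoc a _ _ ⟨
    a + a * (m ∸ w) + b * w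
      ≡⟨ cong (_+ b * w) (*-suc a (m ∸ w)) ⟨
    a * suc (m ∸ w) + b * w
      ≡⟨ cong (λ k → a * k + b * w) (+-∸-assoc 1 (wt-≤ c)) ⟨
    a * (suc m ∸ w) + b * w
      ∎
    where
    open ≡-Reasoning
    w a b : ℕ
    w = wt c
    a = ⟦ suc w ≡ᵇ i ⟧
    b = ⟦ w ≡ᵇ suc i ⟧
  neighboursOfWeight≡ (suc m) (true ∷ c) zero = begin
    neighboursOfWeight (true ∷ c) 0
      ≡⟨ ∑-allWords-suc m _ ⟩
    ∑ (allWords m) (λ v → ⟦ dist c v ≡ᵇ 0 ⟧ * ⟦ wt v ≡ᵇ 0 ⟧) + ∑ (allWords m) (λ v → ⟦ dist c v ≡ᵇ 1 ⟧ * 0)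
      ≡⟨ cong₂ _+_ (∑-dist≡0-* m c (λ v → ⟦ wt v ≡ᵇ 0 ⟧)) none-of-weight-0 ⟩
    ⟦ wt c ≡ᵇ 0 ⟧ + 0
      ≡⟨ lowest (wt c) ⟩
    ⟦ wt c ≡ᵇ 0 ⟧ * suc (wt c)
      ∎
    where
    open ≡-Reasoning
    none-of-weight-0 : ∑ (allWords m) (λ v → ⟦ dist c v ≡ᵇ 1 ⟧ * 0) ≡ 0
    none-of-weight-0 = ≡.trans (∑-cong (allWords m) (λ v → *-zeroʳ ⟦ dist c v ≡ᵇ 1 ⟧)) (∑-zero (allWords m))
    lowest : ∀ w → ⟦ w ≡ᵇ 0 ⟧ + 0 ≡ ⟦ w ≡ᵇ 0 ⟧ * suc w
    lowest zero    = ≡.refl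
    lowest (suc w) = ≡.refl
  neighboursOfWeight≡ (suc m) (true ∷ c) (suc i) = begin
    neighboursOfWeight (true ∷ c) (suc i)
      ≡⟨ ∑-allWords-suc m _ ⟩
    ∑ (allWords m) (λ v → ⟦ dist c v ≡ᵇ 0 ⟧ * ⟦ wt v ≡ᵇ suc i ⟧) + neighboursOfWeight c i
      ≡⟨ cong₂ _+_ (∑-dist≡0-* m c (λ v → ⟦ wt v ≡ᵇ suc i ⟧)) (neighboursOfWeight≡ m c i) ⟩
    b + (a * (m ∸ w) + b * w)
      ≡⟨ x∙yz≈y∙xz b (a * (m ∸ w)) (b * w) ⟩
    a * (m ∸ w) + (b + b * w)
      ≡⟨ cong (a * (m ∸ w) +_) (*-suc b w) ⟨
    a * (m ∸ w) + b * suc w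
      ∎
    where
    open ≡-Reasoning
    w a b : ℕ
    w = wt c
    a = ⟦ suc w ≡ᵇ i ⟧
    b = ⟦ w ≡ᵇ suc i ⟧

  ∣_∣ : ∀ {m} → (Vec Bool m → Bool) → ℕ
  ∣_∣ {m} D = ∑ (allWords m) (λ w → ⟦ D w ⟧)

  weightDistribution : ∀ {m} → (Vec Bool m → Bool) → ℕ → ℕ
  weightDistribution {m} D i = ∑ (allWords m) (λ w → ⟦ D w ⟧ * ⟦ wt w ≡ᵇ i ⟧)

  ∑-weightDistribution : ∀ {m} (D : Vec Bool m → Bool) j (g : ℕ → ℕ) →
    ∑ (allWords m) (λ c → ⟦ D c ⟧ * (⟦ wt c ≡ᵇ j ⟧ * g (wt c))) ≡ weightDistribution D j * g j
  ∑-weightDistribution {m} D j g = begin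
    ∑ (allWords m) (λ c → ⟦ D c ⟧ * (⟦ wt c ≡ᵇ j ⟧ * g (wt c)))
      ≡⟨ ∑-cong (allWords m) (λ c → cong (⟦ D c ⟧ *_) (at-j (wt c))) ⟩
    ∑ (allWords m) (λ c → ⟦ D c ⟧ * (⟦ wt c ≡ᵇ j ⟧ * g j))
      ≡⟨ ∑-cong (allWords m) (λ c → *-assoc ⟦ D c ⟧ _ _) ⟨
    ∑ (allWords m) (λ c → ⟦ D c ⟧ * ⟦ wt c ≡ᵇ j ⟧ * g j)
      ≡⟨ *-distribʳ-∑ (allWords m) (g j) _ ⟨
    weightDistribution D j * g j
      ∎
    where
    open ≡-Reasoning
    at-j : ∀ w → ⟦ w ≡ᵇ j ⟧ * g w ≡ ⟦ w ≡ᵇ j ⟧ * g j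
    at-j w with w ≡ᵇ j in w≡ᵇj
    ... | true  = cong (λ k → 1 * g k) (≡ᵇ⇒≡ w j (subst T (≡.sym w≡ᵇj) _))
    ... | false = ≡.refl

  oppositeParity : ∀ {m} → Bool → Vec Bool m → Bool
  oppositeParity e v = odd (wt v) xor e

  ∣oppositeParity∣ : ∀ m e → ∣ oppositeParity {suc m} e ∣ ≡ 2 ^ m
  ∣oppositeParity∣ m e = begin
    ∣ oppositeParity {suc m} e ∣
      ≡⟨ ∑-allWords-suc m _ ⟩
    ∑ (allWords m) (λ v → ⟦ odd (wt v) xor e ⟧) + ∑ (allWords m) (λ v → ⟦ not (odd (wt v)) xor e ⟧)
      ≡⟨ ∑-distrib-+ (allWords m) _ _ ⟨
    ∑ (allWords m) (λ v → ⟦ odd (wt v) xor e ⟧ + ⟦ not (odd (wt v)) xor e ⟧)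
      ≡⟨ ∑-cong (allWords m) (λ v → exactly-one (odd (wt v)) e) ⟩
    ∑ (allWords m) (λ _ → 1)
      ≡⟨ ∑-allWords-1 m ⟩
    2 ^ m
      ∎
    where
    open ≡-Reasoning
    exactly-one : ∀ x e → ⟦ x xor e ⟧ + ⟦ not x xor e ⟧ ≡ 1
    exactly-one false false = ≡.refl
    exactly-one false true  = ≡.refl
    exactly-one true  false = ≡.refl
    exactly-one true  true  = ≡.refl

  ∈-allVecs : ∀ (xs : List A) n (v : Vec A n) → (∀ a → a ∈ xs) → v ∈ allVecs xs n
  ∈-allVecs xs zero    []      _     = here ≡.refl
  ∈-allVecs xs (suc n) (a ∷ v) all∈ =
    Anyₚ.concatMap⁺ _ (Any.map (λ a≡x → Anyₚ.map⁺ (Any.map (cong₂ _∷_ a≡x) v∈)) (all∈ a))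
    where
    v∈ : v ∈ allVecs xs n
    v∈ = ∈-allVecs xs n v all∈

  ∈-allWords : ∀ {m} (v : Vec Bool m) → v ∈ allWords m
  ∈-allWords v = ∈-allVecs _ _ v λ { false → here ≡.refl ; true → there (here ≡.refl) }

  ⟦⟧*⟦⟧≤1 : ∀ a b → ⟦ a ⟧ * ⟦ b ⟧ ≤ 1
  ⟦⟧*⟦⟧≤1 true  b = subst (_≤ 1) (≡.sym (+-identityʳ _)) (⟦⟧≤1 b)
  ⟦⟧*⟦⟧≤1 false b = z≤n

  ⟦⟧*⟦⟧-pos : ∀ a b → 0 < ⟦ a ⟧ * ⟦ b ⟧ → T a × T b
  ⟦⟧*⟦⟧-pos true true _ = _ , _

  T⇒⟦⟧≡1 : ∀ {b} → T b → ⟦ b ⟧ ≡ 1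
  T⇒⟦⟧≡1 {true} _ = ≡.refl

  *m≡∣oppositeParity∣ : ∀ m n e → n * (2 * m) ≡ 2 ^ m → n * m ≡ ∣ oppositeParity {m} e ∣
  *m≡∣oppositeParity∣ zero    n e n*0≡1 = contradiction (≡.trans (≡.sym n*0≡1) (*-zeroʳ n)) λ ()
  *m≡∣oppositeParity∣ (suc m) n e size  = ≡.trans (*-cancelˡ-≡ _ _ 2 twice) (≡.sym (∣oppositeParity∣ m e))
    where
    twice : 2 * (n * suc m) ≡ 2 * 2 ^ m
    twice = ≡.trans (≡.sym (*-assoc 2 n _))
      (≡.trans (cong (_* suc m) (*-comm 2 n)) (≡.trans (*-assoc n 2 _) size))

  -- Distance 3 is all the covering argument needs: it already makes the radius-1 balls disjoint.
  record IsExtendedPerfectCode {m} (D : Vec Bool m → Bool) (e : Bool) : Set where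
    field
      size      : ∣ D ∣ * (2 * m) ≡ 2 ^ m
      separated : ∀ c c′ → T (D c) → T (D c′) → c ≢ c′ → 3 ≤ dist c c′
      parity    : ∀ c → T (D c) → odd (wt c) ≡ e

  module ExtendedPerfectCode {m} {D : Vec Bool m → Bool} {e : Bool} (isEPC : IsExtendedPerfectCode D e)
    where
    open IsExtendedPerfectCode isEPC

    private
      Ws : List (Vec Bool m)
      Ws = allWords m

    neighbours : Vec Bool m → ℕ
    neighbours v = ∑ (allWords m) (λ c → ⟦ D c ⟧ * ⟦ dist c v ≡ᵇ 1 ⟧)

    neighbours≤1 : ∀ v → neighbours v ≤ 1
    neighbours≤1 v = ∑-allWords-≤1 m _ (λ c → ⟦⟧*⟦⟧≤1 (D c) _) unique
      where
      unique : ∀ c c′ → 0 < ⟦ D c ⟧ * ⟦ dist c v ≡ᵇ 1 ⟧ → 0 < ⟦ D c′ ⟧ * ⟦ dist c′ v ≡ᵇ 1 ⟧ → c ≡ c′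
      unique c c′ p p′ with ⟦⟧*⟦⟧-pos (D c) _ p | ⟦⟧*⟦⟧-pos (D c′) _ p′ | Vecₚ.≡-dec Boolₚ._≟_ c c′
      ... | _   , _  | _    , _   | yes c≡c′ = c≡c′
      ... | c∈D , cv | c′∈D , c′v | no c≢c′  =
        contradiction (≤-trans (separated c c′ c∈D c′∈D c≢c′) dist≤2) (<⇒≱ (s≤s (s≤s (s≤s z≤n))))
        where
        dist≤2 : dist c c′ ≤ 2
        dist≤2 = ≤-trans (dist-triangle c v c′)
          (≤-reflexive (cong₂ _+_ (≡ᵇ⇒≡ _ 1 cv) (≡.trans (dist-comm v c′) (≡ᵇ⇒≡ _ 1 c′v))))

    neighbour⇒oppositeParity : ∀ v → 0 < neighbours v → T (oppositeParity e v)
    neighbour⇒oppositeParity v 0<n with ∑-pos⇒∃-pos (allWords m) _ 0<n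
    ... | c , p with ⟦⟧*⟦⟧-pos (D c) _ p
    ...   | c∈D , cv = subst T (≡.sym (cong (_xor e) flipped)) (not-xor-self e)
      where
      flipped : odd (wt v) ≡ not e
      flipped = ≡.trans (dist≡1⇒odd-wt-flips c v (≡ᵇ⇒≡ _ 1 cv)) (cong not (parity c c∈D))
      not-xor-self : ∀ e → T (not e xor e)
      not-xor-self false = _
      not-xor-self true  = _

    neighbours≤oppositeParity : ∀ v → neighbours v ≤ ⟦ oppositeParity e v ⟧
    neighbours≤oppositeParity v with neighbours v | neighbours≤1 v | neighbour⇒oppositeParity v
    ... | zero  | _   | _   = z≤n
    ... | suc k | ≤1 | opp = subst (suc k ≤_) (≡.sym (T⇒⟦⟧≡1 (opp (s≤s z≤n)))) ≤1

    ∑-neighbours : ∑ (allWords m) neighbours ≡ ∣ D ∣ * m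
    ∑-neighbours = begin
      ∑ Ws neighbours
        ≡⟨ ∑-comm Ws Ws _ ⟩
      ∑ Ws (λ c → ∑ Ws (λ v → ⟦ D c ⟧ * ⟦ dist c v ≡ᵇ 1 ⟧))
        ≡⟨ ∑-cong Ws (λ c → *-distribˡ-∑ Ws ⟦ D c ⟧ _) ⟨
      ∑ Ws (λ c → ⟦ D c ⟧ * ∑ Ws (λ v → ⟦ dist c v ≡ᵇ 1 ⟧))
        ≡⟨ ∑-cong Ws (λ c → cong (⟦ D c ⟧ *_) (∑-dist≡1 m c)) ⟩
      ∑ Ws (λ c → ⟦ D c ⟧ * m)
        ≡⟨ *-distribʳ-∑ Ws m _ ⟨
      ∣ D ∣ * m
        ∎
      where open ≡-Reasoning

    covering : ∀ v → neighbours v ≡ ⟦ oppositeParity e v ⟧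
    covering v = ∑-≤-≡⇒≡ Ws neighbours≤oppositeParity
      (≡.trans ∑-neighbours (*m≡∣oppositeParity∣ m ∣ D ∣ e size)) (∈-allWords v)

    double-counting : ∀ i →
      ∑ (allWords m) (λ c → ⟦ D c ⟧ * neighboursOfWeight c i) ≡ weightDistribution (oppositeParity {m} e) i
    double-counting i = begin
      ∑ Ws (λ c → ⟦ D c ⟧ * neighboursOfWeight c i)
        ≡⟨ ∑-cong Ws (λ c → *-distribˡ-∑ Ws ⟦ D c ⟧ _) ⟩
      ∑ Ws (λ c → ∑ Ws (λ v → ⟦ D c ⟧ * (⟦ dist c v ≡ᵇ 1 ⟧ * ⟦ wt v ≡ᵇ i ⟧)))
        ≡⟨ ∑-comm Ws Ws _ ⟩
      ∑ Ws (λ v → ∑ Ws (λ c → ⟦ D c ⟧ * (⟦ dist c v ≡ᵇ 1 ⟧ * ⟦ wt v ≡ᵇ i ⟧)))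
        ≡⟨ ∑-cong Ws (λ v → ∑-cong Ws (λ c → *-assoc ⟦ D c ⟧ _ _)) ⟨
      ∑ Ws (λ v → ∑ Ws (λ c → ⟦ D c ⟧ * ⟦ dist c v ≡ᵇ 1 ⟧ * ⟦ wt v ≡ᵇ i ⟧))
        ≡⟨ ∑-cong Ws (λ v → *-distribʳ-∑ Ws ⟦ wt v ≡ᵇ i ⟧ _) ⟨
      ∑ Ws (λ v → neighbours v * ⟦ wt v ≡ᵇ i ⟧)
        ≡⟨ ∑-cong Ws (λ v → cong (_* ⟦ wt v ≡ᵇ i ⟧) (covering v)) ⟩
      weightDistribution (oppositeParity {m} e) i
        ∎
      where open ≡-Reasoning

    recurrence₀ : weightDistribution D 1 ≡ weightDistribution (oppositeParity {m} e) 0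
    recurrence₀ = begin
      weightDistribution D 1
        ≡⟨ *-identityʳ _ ⟨
      weightDistribution D 1 * 1
        ≡⟨ ∑-weightDistribution D 1 (λ w → w) ⟨
      ∑ Ws (λ c → ⟦ D c ⟧ * (⟦ wt c ≡ᵇ 1 ⟧ * wt c))
        ≡⟨ ∑-cong Ws (λ c → cong (⟦ D c ⟧ *_) (neighboursOfWeight≡ m c 0)) ⟨
      ∑ Ws (λ c → ⟦ D c ⟧ * neighboursOfWeight c 0)
        ≡⟨ double-counting 0 ⟩
      weightDistribution (oppositeParity {m} e) 0
        ∎
      where open ≡-Reasoning

    recurrence : ∀ i → weightDistribution D i * (m ∸ i) + weightDistribution D (2 + i) * (2 + i)
                       ≡ weightDistribution (oppositeParity {m} e) (suc i)
    recurrence i = begin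
      weightDistribution D i * (m ∸ i) + weightDistribution D (2 + i) * (2 + i)
        ≡⟨ cong₂ _+_ (∑-weightDistribution D i (m ∸_)) (∑-weightDistribution D (2 + i) (λ w → w)) ⟨
      ∑ Ws (λ c → ⟦ D c ⟧ * (⟦ wt c ≡ᵇ i ⟧ * (m ∸ wt c))) + ∑ Ws (λ c → ⟦ D c ⟧ * (⟦ wt c ≡ᵇ 2 + i ⟧ * wt c))
        ≡⟨ ∑-distrib-+ Ws _ _ ⟨
      ∑ Ws (λ c → ⟦ D c ⟧ * (⟦ wt c ≡ᵇ i ⟧ * (m ∸ wt c)) + ⟦ D c ⟧ * (⟦ wt c ≡ᵇ 2 + i ⟧ * wt c))
        ≡⟨ ∑-cong Ws (λ c → *-distribˡ-+ ⟦ D c ⟧ _ _) ⟨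
      ∑ Ws (λ c → ⟦ D c ⟧ * (⟦ wt c ≡ᵇ i ⟧ * (m ∸ wt c) + ⟦ wt c ≡ᵇ 2 + i ⟧ * wt c))
        ≡⟨ ∑-cong Ws (λ c → cong (⟦ D c ⟧ *_) (neighboursOfWeight≡ m c (suc i))) ⟨
      ∑ Ws (λ c → ⟦ D c ⟧ * neighboursOfWeight c (suc i))
        ≡⟨ double-counting (suc i) ⟩
      weightDistribution (oppositeParity {m} e) (suc i)
        ∎
      where open ≡-Reasoning

  recurrence-unique : ∀ m (A B E : ℕ → ℕ) → A 0 ≡ B 0 → A 1 ≡ B 1 →
    (∀ i → A i * (m ∸ i) + A (2 + i) * (2 + i) ≡ E i) →
    (∀ i → B i * (m ∸ i) + B (2 + i) * (2 + i) ≡ E i) →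
    ∀ i → A i ≡ B i
  recurrence-unique m A B E A₀≡B₀ A₁≡B₁ recA recB i = proj₁ (consecutive i)
    where
    consecutive : ∀ i → A i ≡ B i × A (suc i) ≡ B (suc i)
    consecutive zero    = A₀≡B₀ , A₁≡B₁
    consecutive (suc i) with consecutive i
    ... | Aᵢ≡Bᵢ , Aᵢ₊₁≡Bᵢ₊₁ = Aᵢ₊₁≡Bᵢ₊₁ , *-cancelʳ-≡ _ _ (2 + i) (+-cancelˡ-≡ (A i * (m ∸ i)) _ _ same-rhs)
      where
      same-rhs : A i * (m ∸ i) + A (2 + i) * (2 + i) ≡ A i * (m ∸ i) + B (2 + i) * (2 + i)
      same-rhs = ≡.trans (recA i) (≡.trans (≡.sym (recB i)) (cong (λ a → a * (m ∸ i) + _) (≡.sym Aᵢ≡Bᵢ)))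

  weightDistribution-unique : ∀ {m} {D D′ : Vec Bool m → Bool} {e} →
    IsExtendedPerfectCode D e → IsExtendedPerfectCode D′ e →
    weightDistribution D 0 ≡ weightDistribution D′ 0 →
    ∀ i → weightDistribution D i ≡ weightDistribution D′ i
  weightDistribution-unique {m} P P′ eq₀ =
    recurrence-unique m _ _ _ eq₀ (≡.trans C.recurrence₀ (≡.sym C′.recurrence₀)) C.recurrence C′.recurrence
    where
    module C  = ExtendedPerfectCode P
    module C′ = ExtendedPerfectCode P′

module PartitionClasses {k : ℕ} {h : Vec Bool (mOf k) → Fin (2 ^ k)} (P : ExtPerfectPartition k h) where
  open ExtPerfectPartition P
  open Counting
  open import Data.Nat.Properties using (≡ᵇ⇒≡; ≤-trans; n≤1+n; *-zeroʳ)
  open import Data.Fin.Properties using (toℕ-injective; toℕ-fromℕ<)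

  private
    m : ℕ
    m = mOf k

  class-isExtendedPerfectCode : ∀ j → j < 2 ^ k → IsExtendedPerfectCode (inH h j) (odd j)
  class-isExtendedPerfectCode j j<q = record
    { size      = ≡.trans (≡.cong (_* (2 * m)) ∣class∣≡sizeH) (size (Fin.fromℕ< j<q))
    ; separated = λ c c′ c∈ c′∈ c≢c′ → ≤-trans (n≤1+n 3) (distance c c′ (same-h c∈ c′∈) c≢c′)
    ; parity    = λ c c∈ → ≡.trans (odd-cong-%2 (wt c) (toℕ (h c)) (parity c)) (≡.cong odd (in-class c c∈))
    }
    where
    in-class : ∀ c → T (inH h j c) → toℕ (h c) ≡ j
    in-class c = ≡ᵇ⇒≡ (toℕ (h c)) j
    same-h : ∀ {c c′} → T (inH h j c) → T (inH h j c′) → h c ≡ h c′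
    same-h {c} {c′} c∈ c′∈ = toℕ-injective (≡.trans (in-class c c∈) (≡.sym (in-class c′ c′∈)))
    ∣class∣≡sizeH : ∣ inH h j ∣ ≡ sizeH h (toℕ (Fin.fromℕ< j<q))
    ∣class∣≡sizeH = ≡.trans (≡.sym (length-filter-≟ (allWords m) (toℕ ∘′ h) j))
      (≡.cong (sizeH h) (≡.sym (toℕ-fromℕ< j<q)))

  nonzero-class-weightDistribution₀ : ∀ j → weightDistribution (inH h (suc j)) 0 ≡ 0
  nonzero-class-weightDistribution₀ j = ≡.trans (∑-cong (allWords m) no-zero-word) (∑-zero (allWords m))
    where
    no-zero-word : ∀ w → ⟦ inH h (suc j) w ⟧ * ⟦ wt w ≡ᵇ 0 ⟧ ≡ 0
    no-zero-word w with wt w ≡ᵇ 0 in wt≡ᵇ0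
    ... | false = *-zeroʳ ⟦ inH h (suc j) w ⟧
    ... | true rewrite wt≡0⇒≡zero w (≡ᵇ⇒≡ (wt w) 0 (subst T (≡.sym wt≡ᵇ0) _)) | zeroInH0 = ≡.refl

  nonzero-classes-weightDistribution : ∀ i j → suc i < 2 ^ k → suc j < 2 ^ k → odd i ≡ odd j →
    ∀ n → weightDistribution (inH h (suc i)) n ≡ weightDistribution (inH h (suc j)) n
  nonzero-classes-weightDistribution i j i<q j<q odd-i≡odd-j = weightDistribution-unique
    (class-isExtendedPerfectCode (suc i) i<q)
    (subst (IsExtendedPerfectCode (inH h (suc j))) (≡.cong not (≡.sym odd-i≡odd-j))
      (class-isExtendedPerfectCode (suc j) j<q))
    (≡.trans (nonzero-class-weightDistribution₀ i) (≡.sym (nonzero-class-weightDistribution₀ j)))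

module Enumeration {c ℓ : Level} (R : CommutativeSemiring c ℓ) where
  open CommutativeSemiring R renaming (_+_ to _⊕_; _*_ to _⊗_)
  open Enumerators R
  open Sums R
  open import Algebra.Properties.Semiring.Mult semiring using (_×_; ×-congˡ)
  open import Algebra.Properties.CommutativeSemigroup *-commutativeSemigroup
    using () renaming (interchange to *-interchange)
  import Data.Nat.Properties as ℕₚ
  open Counting using (⟦_⟧; weightDistribution; wt-≤; wt-++; ∈-allVecs; odd; %2≡ᵇ1≡odd)
  open import Relation.Binary.Reasoning.Setoid setoid

  private variable A : Set

  ∑-count-× : ∀ (L : List A) (b b′ : A → Bool) x →
    ∑ L (λ a → if b a then (if b′ a then x else 0#) else 0#) ≈ Counting.∑ L (λ a → ⟦ b a ⟧ * ⟦ b′ a ⟧) × x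
  ∑-count-× []      b b′ x = refl
  ∑-count-× (a ∷ L) b b′ x with b a | b′ a
  ... | true  | true  = +-congˡ (∑-count-× L b b′ x)
  ... | true  | false = trans (+-identityˡ _) (∑-count-× L b b′ x)
  ... | false | _     = trans (+-identityˡ _) (∑-count-× L b b′ x)

  ∑-downFrom-none : ∀ B t (g : ℕ → Carrier) → B ≤ t →
    ∑ (List.downFrom B) (λ i → if t ≡ᵇ i then g i else 0#) ≈ 0#
  ∑-downFrom-none zero    t g _   = refl
  ∑-downFrom-none (suc B) t g B<t with t ≡ᵇ B in t≡ᵇB
  ... | true  = contradiction (ℕₚ.≡ᵇ⇒≡ t B (subst T (≡.sym t≡ᵇB) _)) (ℕₚ.>⇒≢ B<t)
  ... | false = trans (+-identityˡ _) (∑-downFrom-none B t g (ℕₚ.<⇒≤ B<t))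

  ∑-downFrom-select : ∀ B t (g : ℕ → Carrier) → t < B →
    ∑ (List.downFrom B) (λ i → if t ≡ᵇ i then g i else 0#) ≈ g t
  ∑-downFrom-select (suc B) t g (s≤s t≤B) with t ≡ᵇ B in t≡ᵇB
  ... | true  rewrite ℕₚ.≡ᵇ⇒≡ t B (subst T (≡.sym t≡ᵇB) _) =
    trans (+-congˡ (∑-downFrom-none B B g ℕₚ.≤-refl)) (+-identityʳ _)
  ... | false = trans (+-identityˡ _) (∑-downFrom-select B t g (ℕₚ.≤∧≢⇒< t≤B t≢B))
    where
    t≢B : t ≢ B
    t≢B t≡B = subst T t≡ᵇB (ℕₚ.≡⇒≡ᵇ t B t≡B)

  ∑-allFin-select : ∀ q (z : Fin q) (g : Fin q → Carrier) →
    ∑ (allFin q) (λ y → if toℕ z ≡ᵇ toℕ y then g y else 0#) ≈ g z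
  ∑-allFin-select (suc q) Fin.zero    g =
    trans (∑-allFin-suc q _) (trans (+-congˡ (∑-zero (allFin q))) (+-identityʳ _))
  ∑-allFin-select (suc q) (Fin.suc z) g =
    trans (∑-allFin-suc q _) (trans (+-identityˡ _) (∑-allFin-select q z (g ∘′ Fin.suc)))

  W-weightDistribution : ∀ m (D : Vec Bool m → Bool) X Y →
    W m D X Y ≈ ∑ (List.downFrom (suc m)) (λ i → weightDistribution D i × (pow X (m ∸ i) ⊗ pow Y i))
  W-weightDistribution m D X Y = begin
    ∑ (allWords m) (λ w → if D w then g (wt w) else 0#)
      ≈⟨ ∑-cong (allWords m) by-weight ⟩
    ∑ (allWords m) (λ w → ∑ (List.downFrom (suc m)) (λ i → if D w then (if wt w ≡ᵇ i then g i else 0#) else 0#))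
      ≈⟨ ∑-comm (allWords m) (List.downFrom (suc m)) _ ⟩
    ∑ (List.downFrom (suc m)) (λ i → ∑ (allWords m) (λ w → if D w then (if wt w ≡ᵇ i then g i else 0#) else 0#))
      ≈⟨ ∑-cong (List.downFrom (suc m)) (λ i → ∑-count-× (allWords m) D (λ w → wt w ≡ᵇ i) (g i)) ⟩
    ∑ (List.downFrom (suc m)) (λ i → weightDistribution D i × g i)
      ∎
    where
    g : ℕ → Carrier
    g i = pow X (m ∸ i) ⊗ pow Y i
    by-weight : ∀ w → (if D w then g (wt w) else 0#)
                      ≈ ∑ (List.downFrom (suc m)) (λ i → if D w then (if wt w ≡ᵇ i then g i else 0#) else 0#)
    by-weight w with D w
    ... | true  = sym (∑-downFrom-select (suc m) (wt w) g (s≤s (wt-≤ w)))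
    ... | false = sym (∑-zero (List.downFrom (suc m)))

  W-cong : ∀ m (D D′ : Vec Bool m → Bool) X Y → (∀ i → weightDistribution D i ≡ weightDistribution D′ i) →
    W m D X Y ≈ W m D′ X Y
  W-cong m D D′ X Y same = begin
    W m D X Y
      ≈⟨ W-weightDistribution m D X Y ⟩
    ∑ (List.downFrom (suc m)) (λ i → weightDistribution D i × (pow X (m ∸ i) ⊗ pow Y i))
      ≈⟨ ∑-cong (List.downFrom (suc m)) (λ i → ×-congˡ (same i)) ⟩
    ∑ (List.downFrom (suc m)) (λ i → weightDistribution D′ i × (pow X (m ∸ i) ⊗ pow Y i))
      ≈⟨ W-weightDistribution m D′ X Y ⟨
    W m D′ X Y
      ∎

  monomial : ∀ {N} → Carrier → Carrier → Vec Bool N → Carrier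
  monomial {N} X Y w = pow X (N ∸ wt w) ⊗ pow Y (wt w)

  pow-+ : ∀ x a b → pow x (a + b) ≈ pow x a ⊗ pow x b
  pow-+ x zero    b = sym (*-identityˡ _)
  pow-+ x (suc a) b = trans (*-congˡ (pow-+ x a b)) (sym (*-assoc _ _ _))

  monomial-++ : ∀ {a b} X Y (u : Vec Bool a) (v : Vec Bool b) →
    monomial X Y (u Vec.++ v) ≈ monomial X Y u ⊗ monomial X Y v
  monomial-++ {a} {b} X Y u v = begin
    pow X ((a + b) ∸ wt (u Vec.++ v)) ⊗ pow Y (wt (u Vec.++ v))
      ≈⟨ reflexive (≡.cong₂ (λ i j → pow X i ⊗ pow Y j) exponent (wt-++ u v)) ⟩
    pow X ((a ∸ wt u) + (b ∸ wt v)) ⊗ pow Y (wt u + wt v)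
      ≈⟨ *-cong (pow-+ X (a ∸ wt u) (b ∸ wt v)) (pow-+ Y (wt u) (wt v)) ⟩
    (pow X (a ∸ wt u) ⊗ pow X (b ∸ wt v)) ⊗ (pow Y (wt u) ⊗ pow Y (wt v))
      ≈⟨ *-interchange _ _ _ _ ⟩
    monomial X Y u ⊗ monomial X Y v
      ∎
    where
    exponent : (a + b) ∸ wt (u Vec.++ v) ≡ (a ∸ wt u) + (b ∸ wt v)
    exponent = ≡.trans (≡.cong ((a + b) ∸_) (wt-++ u v)) (≡.trans (≡.sym (ℕₚ.∸-+-assoc (a + b) (wt u) (wt v)))
      (≡.trans (≡.cong (_∸ wt v) (ℕₚ.+-∸-comm b (wt-≤ u))) (ℕₚ.+-∸-assoc (a ∸ wt u) (wt-≤ v))))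

  monomial-concat : ∀ {m n} X Y (ws : Vec (Vec Bool m) n) →
    monomial X Y (Vec.concat ws) ≈ prodV (Vec.map (monomial X Y) ws)
  monomial-concat X Y []       = *-identityˡ _
  monomial-concat X Y (w ∷ ws) = trans (monomial-++ X Y w (Vec.concat ws)) (*-congˡ (monomial-concat X Y ws))

  ∑-if-*ˡ : ∀ (L : List A) (b : A → Bool) (x : Carrier) (f : A → Carrier) →
    ∑ L (λ a → if b a then x ⊗ f a else 0#) ≈ x ⊗ ∑ L (λ a → if b a then f a else 0#)
  ∑-if-*ˡ L b x f = trans (∑-cong L pull-out) (sym (*-distribˡ-∑ L x _))
    where
    pull-out : ∀ a → (if b a then x ⊗ f a else 0#) ≈ x ⊗ (if b a then f a else 0#)
    pull-out a with b a
    ... | true  = refl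
    ... | false = sym (zeroʳ x)

  ∑-if-*ʳ : ∀ (L : List A) (b : A → Bool) (f : A → Carrier) (x : Carrier) →
    ∑ L (λ a → if b a then f a ⊗ x else 0#) ≈ ∑ L (λ a → if b a then f a else 0#) ⊗ x
  ∑-if-*ʳ L b f x = trans (∑-cong L (λ a → comm (b a))) (trans (∑-if-*ˡ L b x f) (*-comm x _))
    where
    comm : ∀ b′ {a} → (if b′ then f a ⊗ x else 0#) ≈ (if b′ then x ⊗ f a else 0#)
    comm true  = *-comm _ x
    comm false = refl

  CWE-suc : ∀ {q n} (C : Vec (Fin q) (suc n) → Bool) (Xs : Fin q → Carrier) →
    CWE C Xs ≈ ∑ (allFin q) (λ y → Xs y ⊗ CWE (λ x → C (y ∷ x)) Xs)
  CWE-suc {q} {n} C Xs = trans (∑-allVecs-suc (allFin q) n _)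
    (∑-cong (allFin q) (λ y → ∑-if-*ˡ (allCodeWords q n) (λ x → C (y ∷ x)) (Xs y) (prodV ∘′ Vec.map Xs)))

  CWE-cong : ∀ {q n} (C : Vec (Fin q) n → Bool) {Xs Xs′ : Fin q → Carrier} →
    (∀ y → Xs y ≈ Xs′ y) → CWE C Xs ≈ CWE C Xs′
  CWE-cong {q} {n} C {Xs} {Xs′} Xs≈Xs′ = ∑-cong (allCodeWords q n) term≈
    where
    prod≈ : ∀ {k} (x : Vec (Fin q) k) → prodV (Vec.map Xs x) ≈ prodV (Vec.map Xs′ x)
    prod≈ []      = refl
    prod≈ (y ∷ x) = *-cong (Xs≈Xs′ y) (prod≈ x)
    term≈ : ∀ x → (if C x then prodV (Vec.map Xs x) else 0#) ≈ (if C x then prodV (Vec.map Xs′ x) else 0#)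
    term≈ x with C x
    ... | true  = prod≈ x
    ... | false = refl

  T-⇔⇒≡ : ∀ {a b} → (T a → T b) → (T b → T a) → a ≡ b
  T-⇔⇒≡ {false} {false} _ _ = ≡.refl
  T-⇔⇒≡ {false} {true}  _ f = ⊥-elim (f _)
  T-⇔⇒≡ {true}  {false} t _ = ⊥-elim (t _)
  T-⇔⇒≡ {true}  {true}  _ _ = ≡.refl

  module _ {m q} (h : Vec Bool m → Fin q) where

    inΦx-sound : ∀ {n} (x : Vec (Fin q) n) (ws : Vec (Vec Bool m) n) → T (inΦx h x ws) → x ≡ Vec.map h ws
    inΦx-sound []      []       _ = ≡.refl
    inΦx-sound (y ∷ x) (w ∷ ws) t with h w Fin.≟ y
    ... | yes hw≡y = ≡.cong₂ _∷_ (≡.sym hw≡y) (inΦx-sound x ws t)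

    inΦx-complete : ∀ {n} (ws : Vec (Vec Bool m) n) → T (inΦx h (Vec.map h ws) ws)
    inΦx-complete []       = _
    inΦx-complete (w ∷ ws) with h w Fin.≟ h w
    ... | yes _    = inΦx-complete ws
    ... | no hw≢hw = contradiction ≡.refl hw≢hw

    inΦ-map : ∀ {n} (C : Vec (Fin q) n → Bool) (ws : Vec (Vec Bool m) n) → inΦ h C ws ≡ C (Vec.map h ws)
    inΦ-map {n} C ws = T-⇔⇒≡ sound complete
      where
      p : Vec (Fin q) n → Bool
      p x = C x ∧ inΦx h x ws
      sound : T (any p (allCodeWords q n)) → T (C (Vec.map h ws))
      sound t with Any.satisfied (Anyₚ.any⁻ p (allCodeWords q n) t)
      ... | x , px with Equivalence.to Boolₚ.T-∧ px
      ...   | Cx , x∈Φ = subst (T ∘′ C) (inΦx-sound x ws x∈Φ) Cx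
      complete : T (C (Vec.map h ws)) → T (any p (allCodeWords q n))
      complete t = Anyₚ.any⁺ p (Any.map (λ ≡x → subst (T ∘′ p) ≡x p-map-h) (∈-allVecs (allFin q) n _ ∈-allFin))
        where
        p-map-h : T (p (Vec.map h ws))
        p-map-h = Equivalence.from Boolₚ.T-∧ (t , inΦx-complete ws)

    classEnumerator : Carrier → Carrier → Fin q → Carrier
    classEnumerator X Y y = WH h (toℕ y) X Y

    ∑-by-class : ∀ X Y (F : Fin q → Carrier) →
      ∑ (allWords m) (λ w → monomial X Y w ⊗ F (h w)) ≈ ∑ (allFin q) (λ y → classEnumerator X Y y ⊗ F y)
    ∑-by-class X Y F = begin
      ∑ Ws (λ w → monomial X Y w ⊗ F (h w))
        ≈⟨ ∑-cong Ws (λ w → sym (∑-allFin-select q (h w) (λ y → monomial X Y w ⊗ F y))) ⟩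
      ∑ Ws (λ w → ∑ (allFin q) (λ y → if inH h (toℕ y) w then monomial X Y w ⊗ F y else 0#))
        ≈⟨ ∑-comm Ws (allFin q) _ ⟩
      ∑ (allFin q) (λ y → ∑ Ws (λ w → if inH h (toℕ y) w then monomial X Y w ⊗ F y else 0#))
        ≈⟨ ∑-cong (allFin q) (λ y → ∑-if-*ʳ Ws (inH h (toℕ y)) (monomial X Y) (F y)) ⟩
      ∑ (allFin q) (λ y → classEnumerator X Y y ⊗ F y)
        ∎
      where
      Ws : List (Vec Bool m)
      Ws = allWords m

    ∑-blocks : ∀ X Y n (C : Vec (Fin q) n → Bool) →
      ∑ (allVecs (allWords m) n) (λ ws → if C (Vec.map h ws) then prodV (Vec.map (monomial X Y) ws) else 0#)
        ≈ CWE C (classEnumerator X Y)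
    ∑-blocks X Y zero    C = refl
    ∑-blocks X Y (suc n) C = begin
      ∑ (allVecs Ws (suc n)) (λ ws → if C (Vec.map h ws) then prodV (Vec.map mono ws) else 0#)
        ≈⟨ ∑-allVecs-suc Ws n _ ⟩
      ∑ Ws (λ w → ∑ (allVecs Ws n) (λ ws → if C (h w ∷ Vec.map h ws) then mono w ⊗ prodV (Vec.map mono ws) else 0#))
        ≈⟨ ∑-cong Ws (λ w → ∑-if-*ˡ (allVecs Ws n) (λ ws → C (h w ∷ Vec.map h ws)) (mono w) (prodV ∘′ Vec.map mono)) ⟩
      ∑ Ws (λ w → mono w ⊗ ∑ (allVecs Ws n) (λ ws → if C (h w ∷ Vec.map h ws) then prodV (Vec.map mono ws) else 0#))
        ≈⟨ ∑-cong Ws (λ w → *-congˡ (∑-blocks X Y n (λ x → C (h w ∷ x)))) ⟩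
      ∑ Ws (λ w → mono w ⊗ CWE (λ x → C (h w ∷ x)) (classEnumerator X Y))
        ≈⟨ ∑-by-class X Y (λ y → CWE (λ x → C (y ∷ x)) (classEnumerator X Y)) ⟩
      ∑ (allFin q) (λ y → classEnumerator X Y y ⊗ CWE (λ x → C (y ∷ x)) (classEnumerator X Y))
        ≈⟨ CWE-suc C (classEnumerator X Y) ⟨
      CWE C (classEnumerator X Y)
        ∎
      where
      Ws : List (Vec Bool m)
      Ws = allWords m
      mono : Vec Bool m → Carrier
      mono = monomial X Y

    WΦ≈CWE : ∀ {n} (C : Vec (Fin q) n → Bool) X Y → WΦ h C X Y ≈ CWE C (classEnumerator X Y)
    WΦ≈CWE {n} C X Y = trans (∑-cong (allVecs (allWords m) n) term≈) (∑-blocks X Y n C)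
      where
      term≈ : ∀ ws → (if inΦ h C ws then monomial X Y (Vec.concat ws) else 0#)
                     ≈ (if C (Vec.map h ws) then prodV (Vec.map (monomial X Y) ws) else 0#)
      term≈ ws rewrite inΦ-map C ws with C (Vec.map h ws)
      ... | true  = monomial-concat X Y ws
      ... | false = refl

  module _ {k} {h : Vec Bool (mOf k) → Fin (2 ^ k)} (P : ExtPerfectPartition k h) where
    open PartitionClasses P using (nonzero-classes-weightDistribution)
    open import Data.Fin.Properties using (toℕ<n)

    WH≈swSubst : 1 < 2 ^ k → ∀ X Y (y : Fin (2 ^ k)) →
      WH h (toℕ y) X Y ≈ swSubst (WH h 0 X Y) (WH h 1 X Y) (WH h 2 X Y) y
    WH≈swSubst 1<q X Y y with toℕ y | toℕ<n y
    ... | zero        | _     = refl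
    ... | suc zero    | _     = refl
    ... | suc (suc t) | t+2<q rewrite %2≡ᵇ1≡odd t with odd t in odd-t
    ...   | true  = W-cong (mOf k) (inH h (2 + t)) (inH h 1) X Y
                        (nonzero-classes-weightDistribution (suc t) 0 t+2<q 1<q (≡.cong not odd-t))
    ...   | false = W-cong (mOf k) (inH h (2 + t)) (inH h 2) X Y
                        (nonzero-classes-weightDistribution (suc t) 1 t+2<q 2<q (≡.cong not odd-t))
      where
      2<q : 2 < 2 ^ k
      2<q = ℕₚ.≤-trans (s≤s (s≤s (s≤s z≤n))) t+2<q

proposition2 : ∀ {c ℓ : Level} (R : CommutativeSemiring c ℓ) (k n : ℕ) → 1 ≤ k →
    (h : Vec Bool (mOf k) → Fin (2 ^ k)) → ExtPerfectPartition k h →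
    (C : Vec (Fin (2 ^ k)) n → Bool) →
    (X Y : CommutativeSemiring.Carrier R) →
    CommutativeSemiring._≈_ R
      (Enumerators.WΦ R h C X Y)
      (Enumerators.SW R C (Enumerators.WH R h 0 X Y) (Enumerators.WH R h 1 X Y) (Enumerators.WH R h 2 X Y))
proposition2 R (suc k) n _ h P C X Y = trans (WΦ≈CWE h C X Y) (CWE-cong C (WH≈swSubst P 1<2^[1+k] X Y))
  where
  open CommutativeSemiring R using (trans)
  open Enumeration R
  open import Data.Nat.Properties using (≤-trans; *-monoʳ-≤; m^n>0)
  1<2^[1+k] : 1 < 2 ^ suc k
  1<2^[1+k] = ≤-trans (s≤s (s≤s z≤n)) (*-monoʳ-≤ 2 (m^n>0 2 k))
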